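{- For every language $L\subseteq\Sigma^+$: if $L\in\mathtt{incl}\text{ - }\mathtt{ESO}\text{ - }\mathtt{HORN}$, then $\Sigma^+\setminus L$ is generated by a linear conjunctive grammar.
   Context: Word structures: for a finite alphabet $\Sigma$ and a nonempty word $w=w_1\dots w_n\in\Sigma^n$, let $\langle w\rangle=([1,n];(Q_s)_{s\in\Sigma},\mathtt{min},\mathtt{max},\mathtt{suc},\mathtt{pred})$ with $Q_s(i)\iff w_i=s$, $\mathtt{min}(i)\iff i=1$, $\mathtt{max}(i)\iff i=n$, $\mathtt{suc}(i)=i+1$ for $i<n$, $\mathtt{suc}(n)=n$, $\mathtt{pred}(i)=i-1$ for $i>1$, $\mathtt{pred}(1)=1$. For $a\in\mathbb{Z}$, $x+a$ denotes $\mathtt{suc}^a(x)$ if $a\ge0$ and $\mathtt{pred}^{ -a}(x)$ if $a<0$; $x-b$ denotes $x+(-b)$. A formula $\Phi$ defines $\{w\in\Sigma^+:\langle w\rangle\models\Phi\}$. Inclusion Horn formulas ($\mathtt{incl}\text{ - }\mathtt{ESO}\text{ - }\mathtt{HORN}$): $\Phi=\exists\mathbf{R}\,\forall x\forall y\,\psi(x,y)$ with $\mathbf{R}$ a finite set of binary predicate symbols and $\psi$ a finite conjunction of Horn clauses $x\le y\wedge\delta_1\wedge\dots\wedge\delta_r\to\delta_0$, where $\delta_0$ is $R(x,y)$ ($R\in\mathbf{R}$) or $\bot$, and each $\delta_i$ ($i\ge1$) is one of: $U(x+a)$, $\neg U(x+a)$, $U(y+a)$, $\neg U(y+a)$ ($U\in\{(Q_s)_{s\in\Sigma},\mathtt{min},\mathtt{max}\}$,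 $a\in\mathbb{Z}$); $x=y$ or $x<y$; $S(x+a,y-b)\wedge x+a\le y-b$ ($S\in\mathbf{R}$, $a,b\ge0$). Linear conjunctive grammars: $G=(\Sigma,N,P,S)$ with finite nonterminal set $N$, start symbol $S$, rules $A\to\alpha_1\&\dots\&\alpha_k$ ($k\ge1$) where each $\alpha_i$ is a terminal string or $uBv$ with $u,v\in\Sigma^*$, $B\in N$; the languages $L(A)$ form the least solution of $L(A)=\bigcup_{A\to\alpha_1\&\dots\&\alpha_k\in P}\bigcap_iL(\alpha_i)$, and $L(G)=L(S)$. -}

module Defs where

open import Data.Nat using (ℕ; zero; suc; _<_; _≤_; _<ᵇ_)
open import Data.Integer using (ℤ; +_; -[1+_])
open import Data.Fin using (Fin)
open import Data.List using (List; []; _∷_; length; _++_)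
open import Data.List.NonEmpty using (List⁺; toList)
open import Data.List.Membership.Propositional using (_∈_)
open import Data.List.Relation.Unary.All using (All)
open import Data.Maybe using (Maybe; just; nothing)
open import Data.Bool using (Bool; if_then_else_; T)
open import Data.Product using (Σ; ∃; _×_; _,_)
open import Data.Empty using (⊥)
open import Relation.Binary.PropositionalEquality using (_≡_; _≢_)
open import Relation.Nullary using (¬_)
open import Function.Bundles using (_⇔_)

-- Words over the finite alphabet Σ = Fin k.  Words are lists; the
-- structure ⟨w⟩ has domain [1,n] (1-based positions, n = length w).

sucW : ℕ → ℕ → ℕ
sucW n i = if i <ᵇ n then suc i else i

predW : ℕ → ℕ
predW zero = zero
predW (suc zero) = suc zero
predW (suc (suc i)) = suc i

iter : ℕ → (ℕ → ℕ) → ℕ → ℕ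
iter zero f i = i
iter (suc a) f i = f (iter a f i)

shift : ℕ → ℕ → ℤ → ℕ
shift n i (+ a) = iter a (sucW n) i
shift n i -[1+ b ] = iter (suc b) predW i

letterAt : {A : Set} → List A → ℕ → Maybe A
letterAt [] _ = nothing
letterAt (c ∷ w) zero = nothing
letterAt (c ∷ w) (suc zero) = just c
letterAt (c ∷ w) (suc (suc i)) = letterAt w (suc i)

data UPred (k : ℕ) : Set where
  Q     : Fin k → UPred k
  isMin : UPred k
  isMax : UPred k

data Var : Set where
  vx vy : Var

data Lit (k r : ℕ) : Set where
  posU : UPred k → Var → ℤ → Lit k r
  negU : UPred k → Var → ℤ → Lit k r
  eqxy : Lit k r
  ltxy : Lit k r
  rel  : Fin r → ℕ → ℕ → Lit k r            -- S(x+a, y-b) ∧ x+a ≤ y-b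

data Head (r : ℕ) : Set where
  hd  : Fin r → Head r
  bot : Head r

-- Horn clause  x ≤ y ∧ δ₁ ∧ … ∧ δᵣ → δ₀
record Clause (k r : ℕ) : Set where
  constructor clause
  field
    body : List (Lit k r)
    head : Head r

record Formula (k : ℕ) : Set where
  constructor formula
  field
    nRel    : ℕ
    clauses : List (Clause k nRel)

UHolds : {k : ℕ} → List (Fin k) → UPred k → ℕ → Set
UHolds w (Q s) i = letterAt w i ≡ just s
UHolds w isMin i = i ≡ 1
UHolds w isMax i = i ≡ length w

varVal : Var → ℕ → ℕ → ℕ
varVal vx x y = x
varVal vy x y = y

LitHolds : {k r : ℕ} → List (Fin k) → (Fin r → ℕ → ℕ → Bool) →
           ℕ → ℕ → Lit k r → Set
LitHolds w R x y (posU U v a) = UHolds w U (shift (length w) (varVal v x y) a)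
LitHolds w R x y (negU U v a) = ¬ UHolds w U (shift (length w) (varVal v x y) a)
LitHolds w R x y eqxy = x ≡ y
LitHolds w R x y ltxy = x < y
LitHolds w R x y (rel S a b) =
  T (R S (iter a (sucW (length w)) x) (iter b predW y))
  × iter a (sucW (length w)) x ≤ iter b predW y

HeadHolds : {r : ℕ} → (Fin r → ℕ → ℕ → Bool) → ℕ → ℕ → Head r → Set
HeadHolds R x y (hd S) = T (R S x y)
HeadHolds R x y bot = ⊥

Models : {k : ℕ} → List (Fin k) → Formula k → Set
Models w (formula r cls) =
  Σ (Fin r → ℕ → ℕ → Bool) λ R →
    (x y : ℕ) → 1 ≤ x → x ≤ length w → 1 ≤ y → y ≤ length w →
    (c : Clause _ r) → c ∈ cls →
    x ≤ y → All (LitHolds w R x y) (Clause.body c) → HeadHolds R x y (Clause.head c)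

Defines : {k : ℕ} → Formula k → (List (Fin k) → Set) → Set
Defines Φ L = (w : List (Fin _)) → L w ⇔ (w ≢ [] × Models w Φ)

InclESOHorn : {k : ℕ} → (List (Fin k) → Set) → Set
InclESOHorn {k} L = Σ (Formula k) λ Φ → Defines Φ L

data Alt (k m : ℕ) : Set where
  term : List (Fin k) → Alt k m
  nt   : List (Fin k) → Fin m → List (Fin k) → Alt k m

record Rule (k m : ℕ) : Set where
  constructor _⟶_
  field
    lhs : Fin m
    rhs : List⁺ (Alt k m)

record Grammar (k : ℕ) : Set where
  field
    nNT   : ℕ
    start : Fin nNT
    rules : List (Rule k nNT)

module _ {k : ℕ} (G : Grammar k) where
  open Grammar G

  data Derives : Fin nNT → List (Fin k) → Set
  data DerivesAlt : Alt k nNT → List (Fin k) → Set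

  data Derives where
    byRule : ∀ {p w} → p ∈ rules →
             All (λ α → DerivesAlt α w) (toList (Rule.rhs p)) →
             Derives (Rule.lhs p) w

  data DerivesAlt where
    dTerm : ∀ {u} → DerivesAlt (term u) u
    dNt   : ∀ {u B v w} → Derives B w → DerivesAlt (nt u B v) (u ++ w ++ v)

  LangG : List (Fin k) → Set
  LangG = Derives start

-- On every word the Horn clauses have a least model, reached after finitely many rounds of firing
-- clauses.  Replacing each ⊥ head by a fresh relation R₀, which two extra clauses spread from
-- [x + 1, y] and [x, y − 1] to [x, y], a word lies outside L exactly when R₀ holds on [1, n] in that
-- least model.  If C bounds all offsets, whether a clause fires on [x, y] depends only on the letters
-- within C of x and y and on atoms S′(x + a, y − b) of nested intervals.  So a nonterminal (S, p, q)
-- derives the factors on whose interval, cut down by margins p and q, S is derived: a rule picks a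
-- clause, checks its unary and order literals on the first and last K = 2C + 3 letters of the factor
-- (on all of it when the factor is short), which is a linear conjunct ℓ Σ* ρ, and for each literal
-- S′(x + a, y − b) descends to the nested factor by a conjunct u B v.  Soundness is induction on
-- derivations, completeness induction on the round in which an atom enters the least model.
module Submission where

open import Defs
open import Agda.Builtin.Int using (pos; negsuc)
open import Data.Bool using (Bool; true; false; if_then_else_; T; _∨_)
open import Data.Bool.Properties using (T-∨)
open import Data.Empty using (⊥; ⊥-elim)
open import Data.Fin using (Fin; toℕ; fromℕ<; combine; remQuot) renaming (zero to fzero; suc to fsuc; _≟_ to _≟ᶠ_)
open import Data.Fin.Properties using (toℕ-fromℕ<; remQuot-combine)
open import Data.Integer using (∣_∣)
open import Data.List using (List; []; _∷_; length; _++_; take; drop; map; concatMap; filter; upTo; allFin; cartesianProduct; cartesianProductWith)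
open import Data.List.Membership.Propositional using (_∈_; lose; find)
open import Data.List.Membership.Propositional.Properties
open import Data.List.NonEmpty using (toList) renaming (_∷_ to _∷⁺_)
open import Data.List.Properties using (length-++; length-take; length-drop; take++drop≡id; take-take; drop-all; ++-assoc; ++-identityʳ; ++-cancelˡ; ++-cancelʳ)
open import Data.List.Relation.Unary.All using (All; []; _∷_; all?)
import Data.List.Relation.Unary.All as All
open import Data.List.Relation.Unary.All.Properties using () renaming (map⁺ to All-map⁺; map⁻ to All-map⁻)
open import Data.List.Relation.Unary.All.Properties.Core using (¬All⇒Any¬)
open import Data.List.Relation.Unary.Any using (Any; here; there; any?)
open import Data.Maybe using (just)
import Data.Maybe.Properties as Maybe
open import Data.Nat using (ℕ; zero; suc; _+_; _*_; _∸_; _⊓_; _≤_; _<_; z≤n; s≤s; _<ᵇ_; _≤?_; _<?_; _≟_)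
open import Data.Nat.ListAction using (sum)
open import Data.Nat.Properties
open import Data.Nat.Tactic.RingSolver using (solve-∀)
open import Data.Product using (Σ; _×_; _,_; proj₁; proj₂; uncurry)
open import Data.Sum using (_⊎_; inj₁; inj₂; map₂)
open import Data.Unit using (⊤; tt)
open import Function using (id; _∘_)
open import Function.Bundles using (_⇔_; mk⇔; Equivalence)
open import Function.Properties.Equivalence using () renaming (refl to ⇔-refl; trans to ⇔-trans)
open import Function.Related.TypeIsomorphisms using (¬-cong-⇔)
open import Relation.Binary.PropositionalEquality
open import Relation.Nullary using (¬_; yes; no; Dec)
open import Relation.Nullary.Decidable using (¬?; _×-dec_; _→-dec_; ⌊_⌋; toWitness; fromWitness; T?)

length-++-++ : ∀ {X : Set} (A v B : List X) → length (A ++ v ++ B) ≡ length A + (length v + length B)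
length-++-++ A v B = trans (length-++ A) (cong (length A +_) (length-++ v))

length-++-++ʳ : ∀ {X : Set} (ℓ mid ρ : List X) → length (ℓ ++ mid ++ ρ) ≡ length (ℓ ++ mid) + length ρ
length-++-++ʳ ℓ mid ρ = trans (cong length (sym (++-assoc ℓ mid ρ))) (length-++ (ℓ ++ mid))

++-regroup : ∀ {X : Set} (A u g v B : List X) → (A ++ u) ++ g ++ (v ++ B) ≡ A ++ (u ++ g ++ v) ++ B
++-regroup A u g v B = begin
  (A ++ u) ++ g ++ v ++ B   ≡⟨ ++-assoc A u (g ++ v ++ B) ⟩
  A ++ u ++ g ++ v ++ B     ≡⟨ cong (λ h → A ++ u ++ h) (++-assoc g v B) ⟨
  A ++ u ++ (g ++ v) ++ B   ≡⟨ cong (A ++_) (++-assoc u (g ++ v) B) ⟨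
  A ++ (u ++ g ++ v) ++ B   ∎
  where open ≡-Reasoning

take-++ˡ : ∀ {X : Set} n (xs ys : List X) → n ≤ length xs → take n (xs ++ ys) ≡ take n xs
take-++ˡ zero    xs       ys _        = refl
take-++ˡ (suc n) (x ∷ xs) ys (s≤s n≤) = cong (x ∷_) (take-++ˡ n xs ys n≤)

drop-++ʳ : ∀ {X : Set} n (xs ys : List X) → drop (length xs + n) (xs ++ ys) ≡ drop n ys
drop-++ʳ n []       ys = refl
drop-++ʳ n (x ∷ xs) ys = drop-++ʳ n xs ys

take++drop-take++drop : ∀ {X : Set} m n (xs : List X) → m ≤ n → take m xs ++ drop m (take n xs) ++ drop n xs ≡ xs
take++drop-take++drop m n xs m≤n = begin
  take m xs ++ drop m (take n xs) ++ drop n xs            ≡⟨ ++-assoc (take m xs) _ _ ⟨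
  (take m xs ++ drop m (take n xs)) ++ drop n xs          ≡⟨ cong (λ ys → (ys ++ drop m (take n xs)) ++ drop n xs) take-m ⟨
  (take m (take n xs) ++ drop m (take n xs)) ++ drop n xs ≡⟨ cong (_++ drop n xs) (take++drop≡id m (take n xs)) ⟩
  take n xs ++ drop n xs                                  ≡⟨ take++drop≡id n xs ⟩
  xs                                                      ∎
  where
  open ≡-Reasoning
  take-m : take m (take n xs) ≡ take m xs
  take-m = trans (take-take m n xs) (cong (λ i → take i xs) (m≤n⇒m⊓n≡m m≤n))

∈⇒≤sum : ∀ {n ns} → n ∈ ns → n ≤ sum ns
∈⇒≤sum {ns = n ∷ ns} (here refl)  = m≤m+n n (sum ns)
∈⇒≤sum {ns = m ∷ ns} (there n∈ns) = ≤-trans (∈⇒≤sum n∈ns) (m≤n+m (sum ns) m)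

count : ∀ {X : Set} → (X → Bool) → List X → ℕ
count P []       = 0
count P (t ∷ ts) = (if P t then 1 else 0) + count P ts

count-≤-length : ∀ {X : Set} (P : X → Bool) ts → count P ts ≤ length ts
count-≤-length P []       = z≤n
count-≤-length P (t ∷ ts) with P t
... | true  = s≤s (count-≤-length P ts)
... | false = m≤n⇒m≤1+n (count-≤-length P ts)

module _ {X : Set} (P Q : X → Bool) (P⇒Q : ∀ t → T (P t) → T (Q t)) where

  count-mono : ∀ ts → count P ts ≤ count Q ts
  count-mono []       = z≤n
  count-mono (t ∷ ts) with P t | Q t | P⇒Q t
  ... | true  | true  | _  = s≤s (count-mono ts)
  ... | true  | false | pq = ⊥-elim (pq tt)
  ... | false | true  | _  = m≤n⇒m≤1+n (count-mono ts)
  ... | false | false | _  = count-mono ts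

  count-< : ∀ ts → Any (λ t → ¬ (T (Q t) → T (P t))) ts → count P ts < count Q ts
  count-< (t ∷ ts) (here ¬qp) with P t | Q t | P⇒Q t
  ... | true  | _     | _  = ⊥-elim (¬qp (λ _ → tt))
  ... | false | true  | _  = s≤s (count-mono ts)
  ... | false | false | _  = ⊥-elim (¬qp id)
  count-< (t ∷ ts) (there new) with P t | Q t | P⇒Q t
  ... | true  | true  | _  = s≤s (count-< ts new)
  ... | true  | false | pq = ⊥-elim (pq tt)
  ... | false | true  | _  = m≤n⇒m≤1+n (count-< ts new)
  ... | false | false | _  = count-< ts new

sucW-< : ∀ {n i} → i < n → sucW n i ≡ suc i
sucW-< {n} {i} i<n with i <ᵇ n | <⇒<ᵇ i<n
... | true | _ = refl

≤-sucW : ∀ n i → i ≤ sucW n i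
≤-sucW n i with i <ᵇ n
... | true  = n≤1+n i
... | false = ≤-refl

sucW-≤-suc : ∀ n i → sucW n i ≤ suc i
sucW-≤-suc n i with i <ᵇ n
... | true  = ≤-refl
... | false = n≤1+n i

sucW-≤ : ∀ n i → i ≤ n → sucW n i ≤ n
sucW-≤ n i i≤n with i <ᵇ n | <ᵇ⇒< i n
... | true  | i<n = i<n tt
... | false | _   = i≤n

sucW-+ : ∀ c n i → sucW (c + n) (c + i) ≡ c + sucW n i
sucW-+ zero    n i = refl
sucW-+ (suc c) n i = trans (if-suc (c + i <ᵇ c + n)) (cong suc (sucW-+ c n i))
  where
  if-suc : ∀ b → (if b then suc (suc (c + i)) else suc (c + i)) ≡ suc (if b then suc (c + i) else c + i)
  if-suc true  = refl
  if-suc false = refl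

iter-sucW-+ : ∀ a c n i → iter a (sucW (c + n)) (c + i) ≡ c + iter a (sucW n) i
iter-sucW-+ zero    c n i = refl
iter-sucW-+ (suc a) c n i = trans (cong (sucW (c + n)) (iter-sucW-+ a c n i)) (sucW-+ c n _)

iter-sucW-exact : ∀ a i n → i + a ≤ n → iter a (sucW n) i ≡ i + a
iter-sucW-exact zero    i n _  = sym (+-identityʳ i)
iter-sucW-exact (suc a) i n le = begin
  sucW n (iter a (sucW n) i) ≡⟨ cong (sucW n) (iter-sucW-exact a i n (≤-trans (n≤1+n _) le′)) ⟩
  sucW n (i + a)             ≡⟨ sucW-< le′ ⟩
  suc (i + a)                ≡⟨ +-suc i a ⟨
  i + suc a                  ∎
  where
  open ≡-Reasoning
  le′ : suc (i + a) ≤ n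
  le′ = subst (_≤ n) (+-suc i a) le

≤-iter-sucW : ∀ a n i → i ≤ iter a (sucW n) i
≤-iter-sucW zero    n i = ≤-refl
≤-iter-sucW (suc a) n i = ≤-trans (≤-iter-sucW a n i) (≤-sucW n _)

iter-sucW-≤-+ : ∀ a n i → iter a (sucW n) i ≤ i + a
iter-sucW-≤-+ zero    n i = ≤-reflexive (sym (+-identityʳ i))
iter-sucW-≤-+ (suc a) n i = ≤-trans (sucW-≤-suc n _)
  (subst (suc (iter a (sucW n) i) ≤_) (sym (+-suc i a)) (s≤s (iter-sucW-≤-+ a n i)))

iter-sucW-≤ : ∀ a n i → i ≤ n → iter a (sucW n) i ≤ n
iter-sucW-≤ zero    n i i≤n = i≤n
iter-sucW-≤ (suc a) n i i≤n = sucW-≤ n _ (iter-sucW-≤ a n i i≤n)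

predW-≤ : ∀ i → predW i ≤ i
predW-≤ zero          = z≤n
predW-≤ (suc zero)    = ≤-refl
predW-≤ (suc (suc i)) = n≤1+n _

predW-pos : ∀ i → 1 ≤ i → 1 ≤ predW i
predW-pos (suc zero)    _ = s≤s z≤n
predW-pos (suc (suc i)) _ = s≤s z≤n

∸1≤predW : ∀ i → i ∸ 1 ≤ predW i
∸1≤predW zero          = z≤n
∸1≤predW (suc zero)    = z≤n
∸1≤predW (suc (suc i)) = ≤-refl

iter-predW-≤ : ∀ b i → iter b predW i ≤ i
iter-predW-≤ zero    i = ≤-refl
iter-predW-≤ (suc b) i = ≤-trans (predW-≤ _) (iter-predW-≤ b i)

iter-predW-pos : ∀ b i → 1 ≤ i → 1 ≤ iter b predW i
iter-predW-pos zero    i 1≤i = 1≤i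
iter-predW-pos (suc b) i 1≤i = predW-pos _ (iter-predW-pos b i 1≤i)

∸≤iter-predW : ∀ b i → i ∸ b ≤ iter b predW i
∸≤iter-predW zero    i = ≤-refl
∸≤iter-predW (suc b) i = begin
  i ∸ suc b               ≡⟨ cong (i ∸_) (+-comm 1 b) ⟩
  i ∸ (b + 1)             ≡⟨ ∸-+-assoc i b 1 ⟨
  i ∸ b ∸ 1               ≤⟨ ∸-monoˡ-≤ 1 (∸≤iter-predW b i) ⟩
  iter b predW i ∸ 1      ≤⟨ ∸1≤predW _ ⟩
  predW (iter b predW i)  ∎
  where open ≤-Reasoning

iter-predW-exact : ∀ b i → b < i → iter b predW i ≡ i ∸ b
iter-predW-exact zero    i _   = refl
iter-predW-exact (suc b) i b<i = begin
  predW (iter b predW i) ≡⟨ cong predW (iter-predW-exact b i (≤-trans (n≤1+n _) b<i)) ⟩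
  predW (i ∸ b)          ≡⟨ predW-≥2 (i ∸ b) (m+n≤o⇒m≤o∸n 2 b<i) ⟩
  i ∸ b ∸ 1              ≡⟨ ∸-+-assoc i b 1 ⟩
  i ∸ (b + 1)            ≡⟨ cong (i ∸_) (+-comm b 1) ⟩
  i ∸ suc b              ∎
  where
  open ≡-Reasoning
  predW-≥2 : ∀ j → 2 ≤ j → predW j ≡ j ∸ 1
  predW-≥2 (suc (suc j)) _ = refl
  predW-≥2 (suc zero) (s≤s ())

iter-predW-+ : ∀ b c j → b < j → iter b predW (c + j) ≡ c + iter b predW j
iter-predW-+ b c j b<j = begin
  iter b predW (c + j) ≡⟨ iter-predW-exact b (c + j) (≤-trans b<j (m≤n+m j c)) ⟩
  c + j ∸ b            ≡⟨ +-∸-assoc c (<⇒≤ b<j) ⟩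
  c + (j ∸ b)          ≡⟨ cong (c +_) (iter-predW-exact b j b<j) ⟨
  c + iter b predW j   ∎
  where open ≡-Reasoning

shift-pos : ∀ n j t → 1 ≤ j → 1 ≤ shift n j t
shift-pos n j (pos a)    1≤j = ≤-trans 1≤j (≤-iter-sucW a n j)
shift-pos n j (negsuc b) 1≤j = iter-predW-pos (suc b) j 1≤j

shift-≤ : ∀ n j t → j ≤ n → shift n j t ≤ n
shift-≤ n j (pos a)    j≤n = iter-sucW-≤ a n j j≤n
shift-≤ n j (negsuc b) j≤n = ≤-trans (iter-predW-≤ (suc b) j) j≤n

shift-≥2 : ∀ c n j t → ∣ t ∣ ≤ c → suc c < j → 2 ≤ shift n j t
shift-≥2 c n j (pos a)    _   c<j = ≤-trans (s≤s (s≤s z≤n)) (≤-trans c<j (≤-iter-sucW a n j))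
shift-≥2 c n j (negsuc b) t≤c c<j =
  ≤-trans (m+n≤o⇒m≤o∸n 2 (≤-trans (+-monoʳ-≤ 2 t≤c) c<j)) (∸≤iter-predW (suc b) j)

shift-< : ∀ c n j t → ∣ t ∣ ≤ c → j + c < n → shift n j t < n
shift-< c n j (pos a)    t≤c j+c<n = ≤-<-trans (iter-sucW-≤-+ a n j) (≤-<-trans (+-monoʳ-≤ j t≤c) j+c<n)
shift-< c n j (negsuc b) _   j+c<n = ≤-<-trans (iter-predW-≤ (suc b) j) (≤-<-trans (m≤m+n j c) j+c<n)

letterAt-++ʳ : ∀ {X : Set} (A u : List X) i → 1 ≤ i → letterAt (A ++ u) (length A + i) ≡ letterAt u i
letterAt-++ʳ []      u i       _ = refl
letterAt-++ʳ (c ∷ A) u (suc i) _ rewrite +-suc (length A) i =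
  trans (cong (letterAt (A ++ u)) (sym (+-suc (length A) i))) (letterAt-++ʳ A u (suc i) (s≤s z≤n))

letterAt-++ˡ : ∀ {X : Set} (v B : List X) i → i ≤ length v → letterAt (v ++ B) i ≡ letterAt v i
letterAt-++ˡ []      []      zero          _         = refl
letterAt-++ˡ []      (b ∷ B) zero          _         = refl
letterAt-++ˡ (c ∷ v) B       zero          _         = refl
letterAt-++ˡ (c ∷ v) B       (suc zero)    _         = refl
letterAt-++ˡ (c ∷ v) B       (suc (suc i)) (s≤s i≤) = letterAt-++ˡ v B (suc i) i≤

UHolds-++ : ∀ {k} (A v B : List (Fin k)) U i → 1 ≤ i → i ≤ length v →
            (A ≡ [] ⊎ 2 ≤ i) → (B ≡ [] ⊎ i < length v) →
            UHolds (A ++ v ++ B) U (length A + i) ⇔ UHolds v U i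
UHolds-++ A v B (Q s) i 1≤i i≤v _ _
  rewrite letterAt-++ʳ A (v ++ B) i 1≤i | letterAt-++ˡ v B i i≤v = mk⇔ id id
UHolds-++ .[] v B isMin i _ _ (inj₁ refl) _ = mk⇔ id id
UHolds-++ A   v B isMin i _ _ (inj₂ 2≤i)  _ =
  mk⇔ (λ e → ⊥-elim (<⇒≢ (≤-trans 2≤i (m≤n+m i (length A))) (sym e))) (λ e → ⊥-elim (<⇒≢ 2≤i (sym e)))
UHolds-++ A v B isMax i _ _ _ B≈ rewrite length-++-++ A v B =
  mk⇔ (to B≈ ∘ +-cancelˡ-≡ (length A) _ _) (cong (length A +_) ∘ from B≈)
  where
  to : (B ≡ [] ⊎ i < length v) → i ≡ length v + length B → i ≡ length v
  to (inj₁ refl) e = trans e (+-identityʳ _)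
  to (inj₂ i<v)  e = ⊥-elim (<⇒≱ i<v (≤-trans (m≤m+n (length v) (length B)) (≤-reflexive (sym e))))
  from : (B ≡ [] ⊎ i < length v) → i ≡ length v → i ≡ length v + length B
  from (inj₁ refl) e = trans e (sym (+-identityʳ _))
  from (inj₂ i<v)  e = ⊥-elim (<⇒≢ i<v e)

module _ {X : Set} (c : ℕ) where

  iter-sucW-++ : ∀ (A v B : List X) j a → a ≤ c → (B ≡ [] ⊎ j + c < length v) →
                 iter a (sucW (length (A ++ v ++ B))) (length A + j) ≡ length A + iter a (sucW (length v)) j
  iter-sucW-++ A v .[] j a _ (inj₁ refl) rewrite length-++-++ A v [] | +-identityʳ (length v) =
    iter-sucW-+ a (length A) (length v) j
  iter-sucW-++ A v B j a a≤c (inj₂ j+c<v) rewrite length-++-++ A v B = begin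
    iter a (sucW (length A + (length v + length B))) (length A + j)
      ≡⟨ iter-sucW-exact a (length A + j) _ inside-w ⟩
    length A + j + a               ≡⟨ +-assoc (length A) j a ⟩
    length A + (j + a)             ≡⟨ cong (length A +_) (iter-sucW-exact a j (length v) inside-v) ⟨
    length A + iter a (sucW (length v)) j ∎
    where
    open ≡-Reasoning
    inside-v : j + a ≤ length v
    inside-v = ≤-trans (+-monoʳ-≤ j a≤c) (<⇒≤ j+c<v)
    inside-w : length A + j + a ≤ length A + (length v + length B)
    inside-w = subst (_≤ length A + (length v + length B)) (sym (+-assoc (length A) j a))
                 (+-monoʳ-≤ (length A) (≤-trans inside-v (m≤m+n (length v) (length B))))

  iter-predW-++ : ∀ (A : List X) j b → b ≤ c → (A ≡ [] ⊎ suc c < j) →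
                  iter b predW (length A + j) ≡ length A + iter b predW j
  iter-predW-++ .[] j b _   (inj₁ refl) = refl
  iter-predW-++ A   j b b≤c (inj₂ c<j)  = iter-predW-+ b (length A) j (≤-<-trans b≤c (≤-trans (n≤1+n _) c<j))

  shift-++ : ∀ (A v B : List X) j t → ∣ t ∣ ≤ c → (A ≡ [] ⊎ suc c < j) → (B ≡ [] ⊎ j + c < length v) →
             shift (length (A ++ v ++ B)) (length A + j) t ≡ length A + shift (length v) j t
  shift-++ A v B j (pos a)    t≤c _  B≈ = iter-sucW-++ A v B j a t≤c B≈
  shift-++ A v B j (negsuc b) t≤c A≈ _  = iter-predW-++ A j (suc b) t≤c A≈

UHolds-shift-++ : ∀ {k} c (A v B : List (Fin k)) j t U → ∣ t ∣ ≤ c → 1 ≤ j → j ≤ length v →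
                  (A ≡ [] ⊎ suc c < j) → (B ≡ [] ⊎ j + c < length v) →
                  UHolds (A ++ v ++ B) U (shift (length (A ++ v ++ B)) (length A + j) t) ⇔ UHolds v U (shift (length v) j t)
UHolds-shift-++ c A v B j t U t≤c 1≤j j≤v A≈ B≈ rewrite shift-++ c A v B j t t≤c A≈ B≈ =
  UHolds-++ A v B U _ (shift-pos _ j t 1≤j) (shift-≤ _ j t j≤v)
    (map₂ (shift-≥2 c _ j t t≤c) A≈) (map₂ (shift-< c _ j t t≤c) B≈)

UHolds-cong : ∀ {k} {w₁ w₂ : List (Fin k)} {i₁ i₂} U → w₁ ≡ w₂ → i₁ ≡ i₂ →
              UHolds w₁ U i₁ ⇔ UHolds w₂ U i₂
UHolds-cong U refl refl = ⇔-refl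

UHolds-prefix : ∀ {k} c (v B : List (Fin k)) j t U → ∣ t ∣ ≤ c → 1 ≤ j → j + c < length v →
                UHolds (v ++ B) U (shift (length (v ++ B)) j t) ⇔ UHolds v U (shift (length v) j t)
UHolds-prefix c v B j t U t≤c 1≤j j+c<v =
  UHolds-shift-++ c [] v B j t U t≤c 1≤j (≤-trans (m≤m+n j c) (<⇒≤ j+c<v)) (inj₁ refl) (inj₂ j+c<v)

UHolds-suffix : ∀ {k} c (A v : List (Fin k)) j t U → ∣ t ∣ ≤ c → j ≤ length v → suc c < j →
                UHolds (A ++ v) U (shift (length (A ++ v)) (length A + j) t) ⇔ UHolds v U (shift (length v) j t)
UHolds-suffix c A v j t U t≤c j≤v c<j
  rewrite sym (cong (A ++_) (++-identityʳ v)) =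
  UHolds-shift-++ c A v [] j t U t≤c (≤-trans (s≤s z≤n) c<j) j≤v (inj₂ c<j) (inj₁ refl)

-- The factor f of A ++ f ++ B with margins p and q stands for the interval [|A| + p + 1, |A| + |f| − q]
-- of the whole word; a margin shorter than M is only allowed at an end of the word.
record Framed (M : ℕ) {X : Set} (A f B : List X) (p q : ℕ) : Set where
  field
    p≤M   : p ≤ M
    q≤M   : q ≤ M
    A≈    : A ≡ [] ⊎ p ≡ M
    B≈    : B ≡ [] ⊎ q ≡ M
    p+q<f : p + q < length f

-- The factor of f framing the interval [X₀, Y₀] of f with margins of up to M letters.
module Cut (M : ℕ) {X : Set} (f : List X) (X₀ Y₀ : ℕ) where
  p′ q′ : ℕ
  p′ = M ⊓ (X₀ ∸ 1)
  q′ = M ⊓ (length f ∸ Y₀)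

  prefix factor suffix : List X
  prefix = take (X₀ ∸ 1 ∸ p′) f
  factor = drop (X₀ ∸ 1 ∸ p′) (take (Y₀ + q′) f)
  suffix = drop (Y₀ + q′) f

module FramedCut (M : ℕ) {X : Set} {A f B : List X} {p q : ℕ} (fr : Framed M A f B p q)
         {X₀ Y₀ : ℕ} (p<X₀ : suc p ≤ X₀) (X₀≤Y₀ : X₀ ≤ Y₀) (Y₀≤ : Y₀ ≤ length f ∸ q) where
  open Framed fr
  open Cut M f X₀ Y₀ public

  private
    F #prefix : ℕ
    F       = length f
    #prefix = X₀ ∸ 1 ∸ p′

    Y₀≤F : Y₀ ≤ F
    Y₀≤F = ≤-trans Y₀≤ (m∸n≤m F q)

    #prefix≤Y₀ : #prefix ≤ Y₀
    #prefix≤Y₀ = ≤-trans (m∸n≤m (X₀ ∸ 1) p′) (≤-trans (m∸n≤m X₀ 1) X₀≤Y₀)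

    length-A++prefix : length (A ++ prefix) ≡ length A + #prefix
    length-A++prefix = trans (length-++ A)
      (cong (length A +_) (trans (length-take #prefix f) (m≤n⇒m⊓n≡m (≤-trans #prefix≤Y₀ Y₀≤F))))

    length-factor : length factor ≡ (Y₀ ∸ #prefix) + q′
    length-factor = begin
      length factor                       ≡⟨ length-drop #prefix (take (Y₀ + q′) f) ⟩
      length (take (Y₀ + q′) f) ∸ #prefix ≡⟨ cong (_∸ #prefix) (length-take (Y₀ + q′) f) ⟩
      (Y₀ + q′) ⊓ F ∸ #prefix             ≡⟨ cong (_∸ #prefix) (m≤n⇒m⊓n≡m Y₀+q′≤F) ⟩
      Y₀ + q′ ∸ #prefix                   ≡⟨ +-∸-comm q′ #prefix≤Y₀ ⟩
      (Y₀ ∸ #prefix) + q′                 ∎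
      where
      open ≡-Reasoning
      Y₀+q′≤F : Y₀ + q′ ≤ F
      Y₀+q′≤F = ≤-trans (+-monoʳ-≤ Y₀ (m⊓n≤n M (F ∸ Y₀))) (≤-reflexive (m+[n∸m]≡n Y₀≤F))

    #prefix+1+p′ : #prefix + suc p′ ≡ X₀
    #prefix+1+p′ = begin
      #prefix + suc p′   ≡⟨ +-suc #prefix p′ ⟩
      suc (#prefix + p′) ≡⟨ cong suc (m∸n+n≡m (m⊓n≤n M (X₀ ∸ 1))) ⟩
      suc (X₀ ∸ 1)       ≡⟨ +-comm 1 (X₀ ∸ 1) ⟩
      X₀ ∸ 1 + 1         ≡⟨ m∸n+n≡m (≤-trans (s≤s z≤n) p<X₀) ⟩
      X₀                 ∎
      where open ≡-Reasoning

  cut-split : f ≡ prefix ++ factor ++ suffix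
  cut-split = sym (take++drop-take++drop #prefix (Y₀ + q′) f (≤-trans #prefix≤Y₀ (m≤m+n Y₀ q′)))

  cut-context : A ++ f ++ B ≡ (A ++ prefix) ++ factor ++ (suffix ++ B)
  cut-context = trans (cong (λ g → A ++ g ++ B) cut-split) (sym (++-regroup A prefix factor suffix B))

  cut-middle : ∀ {g} → f ≡ prefix ++ g ++ suffix → g ≡ factor
  cut-middle {g} f≡ = ++-cancelʳ suffix g factor (++-cancelˡ prefix (g ++ suffix) (factor ++ suffix) (trans (sym f≡) cut-split))

  cut-start : length (A ++ prefix) + suc p′ ≡ length A + X₀
  cut-start = begin
    length (A ++ prefix) + suc p′ ≡⟨ cong (_+ suc p′) length-A++prefix ⟩
    length A + #prefix + suc p′   ≡⟨ +-assoc (length A) #prefix (suc p′) ⟩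
    length A + (#prefix + suc p′) ≡⟨ cong (length A +_) #prefix+1+p′ ⟩
    length A + X₀                 ∎
    where open ≡-Reasoning

  cut-end : length (A ++ prefix) + (length factor ∸ q′) ≡ length A + Y₀
  cut-end = begin
    length (A ++ prefix) + (length factor ∸ q′)
      ≡⟨ cong₂ _+_ length-A++prefix (trans (cong (_∸ q′) length-factor) (m+n∸n≡m (Y₀ ∸ #prefix) q′)) ⟩
    length A + #prefix + (Y₀ ∸ #prefix)   ≡⟨ +-assoc (length A) #prefix (Y₀ ∸ #prefix) ⟩
    length A + (#prefix + (Y₀ ∸ #prefix)) ≡⟨ cong (length A +_) (m+[n∸m]≡n #prefix≤Y₀) ⟩
    length A + Y₀                         ∎
    where open ≡-Reasoning

  cut-left-margin : A ++ prefix ≡ [] ⊎ p′ ≡ M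
  cut-left-margin with M ≤? X₀ ∸ 1
  ... | yes M≤ = inj₂ (m≤n⇒m⊓n≡m M≤)
  ... | no  M≰ = inj₁ (cong₂ _++_ A≡[] prefix≡[])
    where
    X₀∸1<M : X₀ ∸ 1 < M
    X₀∸1<M = ≰⇒> M≰
    prefix≡[] : prefix ≡ []
    prefix≡[] = cong (λ n → take n f)
      (trans (cong (X₀ ∸ 1 ∸_) (m≥n⇒m⊓n≡n (<⇒≤ X₀∸1<M))) (n∸n≡0 (X₀ ∸ 1)))
    p≤X₀∸1 : p ≤ X₀ ∸ 1
    p≤X₀∸1 = m+n≤o⇒m≤o∸n p (subst (_≤ X₀) (+-comm 1 p) p<X₀)
    A≡[] : A ≡ []
    A≡[] with A≈
    ... | inj₁ A≡[] = A≡[]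
    ... | inj₂ p≡M  = ⊥-elim (<⇒≱ X₀∸1<M (subst (_≤ X₀ ∸ 1) p≡M p≤X₀∸1))

  cut-right-margin : suffix ++ B ≡ [] ⊎ q′ ≡ M
  cut-right-margin with M ≤? F ∸ Y₀
  ... | yes M≤ = inj₂ (m≤n⇒m⊓n≡m M≤)
  ... | no  M≰ = inj₁ (cong₂ _++_ suffix≡[] B≡[])
    where
    F∸Y₀<M : F ∸ Y₀ < M
    F∸Y₀<M = ≰⇒> M≰
    suffix≡[] : suffix ≡ []
    suffix≡[] = drop-all (Y₀ + q′) f
      (≤-reflexive (sym (trans (cong (Y₀ +_) (m≥n⇒m⊓n≡n (<⇒≤ F∸Y₀<M))) (m+[n∸m]≡n Y₀≤F))))
    q≤F∸Y₀ : q ≤ F ∸ Y₀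
    q≤F∸Y₀ = ≤-trans (≤-reflexive (sym (m∸[m∸n]≡n (≤-trans (m≤n+m q p) (<⇒≤ p+q<f))))) (∸-monoʳ-≤ F Y₀≤)
    B≡[] : B ≡ []
    B≡[] with B≈
    ... | inj₁ B≡[] = B≡[]
    ... | inj₂ q≡M  = ⊥-elim (<⇒≱ F∸Y₀<M (subst (_≤ F ∸ Y₀) q≡M q≤F∸Y₀))

  cut-margins-fit : p′ + q′ < length factor
  cut-margins-fit = subst (p′ + q′ <_) (sym length-factor) (+-monoˡ-< q′ (m+n≤o⇒m≤o∸n (suc p′) 1+p′+#prefix≤Y₀))
    where
    1+p′+#prefix≤Y₀ : suc p′ + #prefix ≤ Y₀
    1+p′+#prefix≤Y₀ = ≤-trans (≤-reflexive (trans (+-comm (suc p′) #prefix) #prefix+1+p′)) X₀≤Y₀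

  cut-framed : Framed M (A ++ prefix) factor (suffix ++ B) p′ q′
  cut-framed = record
    { p≤M = m⊓n≤m M (X₀ ∸ 1) ; q≤M = m⊓n≤m M (F ∸ Y₀)
    ; A≈ = cut-left-margin ; B≈ = cut-right-margin ; p+q<f = cut-margins-fit }

module _ (M : ℕ) {X : Set} where

  cut-prefix-++ : ∀ (ℓ w : List X) X₀ Y₀ Y₁ → X₀ ≤ length ℓ →
                  Cut.prefix M (ℓ ++ w) X₀ Y₀ ≡ Cut.prefix M ℓ X₀ Y₁
  cut-prefix-++ ℓ w X₀ _ _ X₀≤ℓ =
    take-++ˡ _ ℓ w (≤-trans (m∸n≤m (X₀ ∸ 1) (M ⊓ (X₀ ∸ 1))) (≤-trans (m∸n≤m X₀ 1) X₀≤ℓ))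

  cut-q′-++ : ∀ (w ρ : List X) X₀ X₁ Y₀ → Cut.q′ M (w ++ ρ) X₀ (length w + Y₀) ≡ Cut.q′ M ρ X₁ Y₀
  cut-q′-++ w ρ _ _ Y₀ =
    cong (M ⊓_) (trans (cong (_∸ (length w + Y₀)) (length-++ w)) ([m+n]∸[m+o]≡n∸o (length w) (length ρ) Y₀))

  cut-suffix-++ : ∀ (w ρ : List X) X₀ X₁ Y₀ → Cut.suffix M (w ++ ρ) X₀ (length w + Y₀) ≡ Cut.suffix M ρ X₁ Y₀
  cut-suffix-++ w ρ X₀ X₁ Y₀ = begin
    drop (length w + Y₀ + Cut.q′ M (w ++ ρ) X₀ (length w + Y₀)) (w ++ ρ)
      ≡⟨ cong (λ n → drop (length w + Y₀ + n) (w ++ ρ)) (cut-q′-++ w ρ X₀ X₁ Y₀) ⟩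
    drop (length w + Y₀ + Cut.q′ M ρ X₁ Y₀) (w ++ ρ)
      ≡⟨ cong (λ n → drop n (w ++ ρ)) (+-assoc (length w) Y₀ _) ⟩
    drop (length w + (Y₀ + Cut.q′ M ρ X₁ Y₀)) (w ++ ρ)
      ≡⟨ drop-++ʳ _ w ρ ⟩
    Cut.suffix M ρ X₁ Y₀ ∎
    where open ≡-Reasoning

module Views (k r C : ℕ) where

  -- The grammar sees a factor only through its view: the factor itself when shorter than 2K, else
  -- its first and last K letters.  K = 2C + 3 fits a margin of at most M = C + 1 letters and the
  -- offsets of up to C around x (resp. y) into the first (resp. last) K letters.
  M K : ℕ
  M = suc C
  K = suc (suc (suc (C + C)))

  Word : Set
  Word = List (Fin k)

  data View : Set where
    short : Word → View
    long  : Word → Word → View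

  viewˡ viewʳ : View → Word
  viewˡ (short g)  = g
  viewˡ (long ℓ ρ) = ℓ
  viewʳ (short g)  = g
  viewʳ (long ℓ ρ) = ρ

  data _represents_ : View → Word → Set where
    whole : ∀ {f} → short f represents f
    ends  : ∀ {ℓ ρ} mid → length ℓ ≡ K → length ρ ≡ K → long ℓ ρ represents (ℓ ++ mid ++ ρ)

  viewWord : View → Var → Word
  viewWord v vx = viewˡ v
  viewWord v vy = viewʳ v

  viewPos : View → ℕ → ℕ → Var → ℕ
  viewPos v p q vx = suc p
  viewPos v p q vy = length (viewʳ v) ∸ q

  viewStart : View → ℕ → ℕ → ℕ
  viewStart v p a = iter a (sucW (length (viewˡ v))) (suc p)

  viewEnd : View → ℕ → ℕ → ℕ
  viewEnd v q b = iter b predW (length (viewʳ v) ∸ q)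

  ViewLit : View → ℕ → ℕ → Lit k r → Set
  ViewLit v p q (posU U var t) = UHolds (viewWord v var) U (shift (length (viewWord v var)) (viewPos v p q var) t)
  ViewLit v p q (negU U var t) = ¬ UHolds (viewWord v var) U (shift (length (viewWord v var)) (viewPos v p q var) t)
  ViewLit (short g)  p q eqxy        = suc p ≡ length g ∸ q
  -- In a long view, x and y are far apart (ends-apart).
  ViewLit (long _ _) p q eqxy        = ⊥
  ViewLit (short g)  p q ltxy        = suc p < length g ∸ q
  ViewLit (long _ _) p q ltxy        = ⊤
  ViewLit (short g)  p q (rel S a b) = viewStart (short g) p a ≤ viewEnd (short g) q b
  ViewLit (long _ _) p q (rel S a b) = ⊤

  Bounded : Lit k r → Set
  Bounded (posU _ _ t) = ∣ t ∣ ≤ C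
  Bounded (negU _ _ t) = ∣ t ∣ ≤ C
  Bounded eqxy         = ⊤
  Bounded ltxy         = ⊤
  Bounded (rel _ a b)  = a ≤ C × b ≤ C

  1+p+C<K : ∀ {p} → p ≤ M → suc p + C < K
  1+p+C<K p≤M = s≤s (s≤s (+-monoˡ-≤ C p≤M))

  1+C<K∸q : ∀ {q} → q ≤ M → suc C < K ∸ q
  1+C<K∸q {q} q≤M = m+n≤o⇒m≤o∸n (suc (suc C)) (≤-trans (+-monoʳ-≤ (suc (suc C)) q≤M) (≤-reflexive (2+C+M≡K C)))
    where
    2+C+M≡K : ∀ C → suc (suc C) + suc C ≡ suc (suc (suc (C + C)))
    2+C+M≡K = solve-∀

  q≤K : ∀ {q} → q ≤ M → q ≤ K
  q≤K q≤M = ≤-trans q≤M (s≤s (≤-trans (m≤m+n C C) (≤-trans (n≤1+n _) (n≤1+n _))))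

  ends-apart : ∀ {F p q a b} → K + K ≤ F → p ≤ M → q ≤ M → a ≤ C → b ≤ C → suc p + a < F ∸ q ∸ b
  ends-apart {F} {p} {q} {a} {b} 2K≤F p≤M q≤M a≤C b≤C = subst (suc p + a <_) (sym (∸-+-assoc F q b))
    (m+n≤o⇒m≤o∸n (suc (suc p + a)) (begin
      suc (suc p + a) + (q + b)         ≤⟨ +-mono-≤ (s≤s (s≤s (+-mono-≤ p≤M a≤C))) (+-mono-≤ q≤M b≤C) ⟩
      suc (suc M + C) + (M + C)         ≤⟨ m≤m+n _ 2 ⟩
      suc (suc M + C) + (M + C) + 2     ≡⟨ 4C+6≡K+K C ⟩
      K + K                             ≤⟨ 2K≤F ⟩
      F                                 ∎))
    where
    open ≤-Reasoning
    4C+6≡K+K : ∀ C → suc (suc (suc C) + C) + (suc C + C) + 2 ≡ suc (suc (suc (C + C))) + suc (suc (suc (C + C)))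
    4C+6≡K+K = solve-∀

  long-lengths : ∀ {ℓ ρ f} → long ℓ ρ represents f → length ℓ ≡ K × length ρ ≡ K
  long-lengths (ends _ ℓ≡K ρ≡K) = ℓ≡K , ρ≡K

  2K≤long : ∀ {ℓ ρ f} → long ℓ ρ represents f → K + K ≤ length f
  2K≤long (ends {ℓ} {ρ} mid ℓ≡K ρ≡K) = begin
    K + K                            ≡⟨ cong₂ _+_ ℓ≡K ρ≡K ⟨
    length ℓ + length ρ              ≤⟨ +-monoˡ-≤ (length ρ) (m≤m+n (length ℓ) (length mid)) ⟩
    length ℓ + length mid + length ρ ≡⟨ cong (_+ length ρ) (length-++ ℓ) ⟨
    length (ℓ ++ mid) + length ρ     ≡⟨ length-++-++ʳ ℓ mid ρ ⟨
    length (ℓ ++ mid ++ ρ)           ∎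
    where open ≤-Reasoning

  module _ {ℓ mid ρ : Word} (ℓ≡K : length ℓ ≡ K) (ρ≡K : length ρ ≡ K) where

    end-pos-long : ∀ {q} → q ≤ M → length (ℓ ++ mid ++ ρ) ∸ q ≡ length (ℓ ++ mid) + (length ρ ∸ q)
    end-pos-long {q} q≤M = trans (cong (_∸ q) (length-++-++ʳ ℓ mid ρ))
      (+-∸-assoc (length (ℓ ++ mid)) (subst (q ≤_) (sym ρ≡K) (q≤K q≤M)))

    start-long : ∀ {p a} → p ≤ M → a ≤ C →
      iter a (sucW (length (ℓ ++ mid ++ ρ))) (suc p) ≡ viewStart (long ℓ ρ) p a
    start-long p≤M a≤C = iter-sucW-++ C [] ℓ (mid ++ ρ) _ _ a≤C (inj₂ (subst (_ <_) (sym ℓ≡K) (1+p+C<K p≤M)))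

    start-long-≤ : ∀ {p a} → p ≤ M → a ≤ C → viewStart (long ℓ ρ) p a ≤ length ℓ
    start-long-≤ {p} {a} p≤M a≤C = ≤-trans (iter-sucW-≤-+ a (length ℓ) (suc p))
      (≤-trans (<⇒≤ (≤-<-trans (+-monoʳ-≤ (suc p) a≤C) (1+p+C<K p≤M))) (≤-reflexive (sym ℓ≡K)))

    end-long : ∀ {q b} → q ≤ M → b ≤ C →
      iter b predW (length (ℓ ++ mid ++ ρ) ∸ q) ≡ length (ℓ ++ mid) + viewEnd (long ℓ ρ) q b
    end-long {q} {b} q≤M b≤C = trans (cong (iter b predW) (end-pos-long q≤M))
      (iter-predW-++ C (ℓ ++ mid) (length ρ ∸ q) b b≤C (inj₂ (subst (λ n → suc C < n ∸ q) (sym ρ≡K) (1+C<K∸q q≤M))))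

  RelFree : Lit k r → Set
  RelFree (rel _ _ _) = ⊥
  RelFree _           = ⊤

  module Framing {A f B : Word} {p q : ℕ} (fr : Framed M A f B p q) where
    open Framed fr

    w : Word
    w = A ++ f ++ B

    F x y : ℕ
    F = length f
    x = length A + suc p
    y = length A + (F ∸ q)

    1+p≤F∸q : suc p ≤ F ∸ q
    1+p≤F∸q = m+n≤o⇒m≤o∸n (suc p) p+q<f

    q<F : q < F
    q<F = ≤-trans (s≤s (m≤n+m q p)) p+q<f

    x≤y : x ≤ y
    x≤y = +-monoʳ-≤ (length A) 1+p≤F∸q

    pos-x : 1 ≤ x
    pos-x = ≤-trans (s≤s z≤n) (m≤n+m (suc p) (length A))

    y≤w : y ≤ length w
    y≤w = subst (y ≤_) (sym (length-++-++ A f B)) (+-monoʳ-≤ (length A) (≤-trans (m∸n≤m F q) (m≤m+n F (length B))))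

    -- Positions within C of x or y stay inside f, unless A or B is empty.
    x-left : A ≡ [] ⊎ suc C < suc p
    x-left = map₂ (λ p≡M → s≤s (≤-reflexive (sym p≡M))) A≈

    x-right : B ≡ [] ⊎ suc p + C < F
    x-right = map₂ (λ q≡M → subst (_< F) (trans (cong (p +_) q≡M) (+-suc p C)) p+q<f) B≈

    y-left : A ≡ [] ⊎ suc C < F ∸ q
    y-left = map₂ (λ p≡M → subst (λ n → suc n ≤ F ∸ q) p≡M 1+p≤F∸q) A≈

    y-right : B ≡ [] ⊎ F ∸ q + C < F
    y-right = map₂ (λ q≡M → ≤-reflexive (begin
      suc (F ∸ q + C) ≡⟨ +-suc (F ∸ q) C ⟨
      F ∸ q + suc C   ≡⟨ cong (F ∸ q +_) q≡M ⟨
      F ∸ q + q       ≡⟨ m∸n+n≡m (<⇒≤ q<F) ⟩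
      F               ∎)) B≈
      where open ≡-Reasoning

    UHolds-factor : ∀ var t U → ∣ t ∣ ≤ C →
      UHolds w U (shift (length w) (varVal var x y) t) ⇔ UHolds f U (shift F (varVal var (suc p) (F ∸ q)) t)
    UHolds-factor vx t U t≤C =
      UHolds-shift-++ C A f B (suc p) t U t≤C (s≤s z≤n) (≤-trans (s≤s (m≤m+n p q)) p+q<f) x-left x-right
    UHolds-factor vy t U t≤C = UHolds-shift-++ C A f B (F ∸ q) t U t≤C (m+n≤o⇒m≤o∸n 1 q<F) (m∸n≤m F q) y-left y-right

    UHolds-view : ∀ {v} → v represents f → ∀ var t U → ∣ t ∣ ≤ C →
      UHolds f U (shift F (varVal var (suc p) (F ∸ q)) t) ⇔ ViewLit v p q (posU U var t)
    UHolds-view whole vx t U t≤C = ⇔-refl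
    UHolds-view whole vy t U t≤C = ⇔-refl
    UHolds-view (ends {ℓ} {ρ} mid ℓ≡K ρ≡K) vx t U t≤C =
      UHolds-prefix C ℓ (mid ++ ρ) (suc p) t U t≤C (s≤s z≤n) (subst (suc p + C <_) (sym ℓ≡K) (1+p+C<K p≤M))
    UHolds-view (ends {ℓ} {ρ} mid ℓ≡K ρ≡K) vy t U t≤C =
      ⇔-trans (UHolds-cong U (sym assoc) (cong₂ (λ n i → shift n i t) (cong length (sym assoc))
                                                 (end-pos-long {ℓ} {mid} {ρ} ℓ≡K ρ≡K q≤M)))
        (UHolds-suffix C (ℓ ++ mid) ρ (length ρ ∸ q) t U t≤C (m∸n≤m (length ρ) q)
          (subst (λ n → suc C < n ∸ q) (sym ρ≡K) (1+C<K∸q q≤M)))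
      where
      assoc : (ℓ ++ mid) ++ ρ ≡ ℓ ++ mid ++ ρ
      assoc = ++-assoc ℓ mid ρ

    UHolds⇔ViewLit : ∀ {v} → v represents f → ∀ var t U → ∣ t ∣ ≤ C →
      UHolds w U (shift (length w) (varVal var x y) t) ⇔ ViewLit v p q (posU U var t)
    UHolds⇔ViewLit rep var t U t≤C = ⇔-trans (UHolds-factor var t U t≤C) (UHolds-view rep var t U t≤C)

    x<y-long : ∀ {ℓ ρ} → long ℓ ρ represents f → suc p < F ∸ q
    x<y-long rep = subst (_< F ∸ q) (+-identityʳ (suc p)) (ends-apart (2K≤long rep) p≤M q≤M z≤n z≤n)

    LitHolds⇔ViewLit : ∀ {v} → v represents f → ∀ l → Bounded l → RelFree l → ∀ R →
      LitHolds w R x y l ⇔ ViewLit v p q l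
    LitHolds⇔ViewLit rep   (posU U var t) t≤C _ R = UHolds⇔ViewLit rep var t U t≤C
    LitHolds⇔ViewLit rep   (negU U var t) t≤C _ R = ¬-cong-⇔ (UHolds⇔ViewLit rep var t U t≤C)
    LitHolds⇔ViewLit whole eqxy _ _ R = mk⇔ (+-cancelˡ-≡ (length A) _ _) (cong (length A +_))
    LitHolds⇔ViewLit whole ltxy _ _ R = mk⇔ (+-cancelˡ-< (length A) _ _) (+-monoʳ-< (length A))
    LitHolds⇔ViewLit rep@(ends _ _ _) eqxy _ _ R =
      mk⇔ (λ x≡y → <⇒≢ (x<y-long rep) (+-cancelˡ-≡ (length A) _ _ x≡y)) ⊥-elim
    LitHolds⇔ViewLit rep@(ends _ _ _) ltxy _ _ R = mk⇔ (λ _ → tt) (λ _ → +-monoʳ-< (length A) (x<y-long rep))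

    module RelLit {a b : ℕ} (a≤C : a ≤ C) (b≤C : b ≤ C) where
      X₀ Y₀ : ℕ
      X₀ = iter a (sucW F) (suc p)
      Y₀ = iter b predW (F ∸ q)

      rel-start : iter a (sucW (length w)) x ≡ length A + X₀
      rel-start = iter-sucW-++ C A f B (suc p) a a≤C x-right

      rel-end : iter b predW y ≡ length A + Y₀
      rel-end = iter-predW-++ C A (F ∸ q) b b≤C y-left

      1+p≤X₀ : suc p ≤ X₀
      1+p≤X₀ = ≤-iter-sucW a F (suc p)

      Y₀≤F∸q : Y₀ ≤ F ∸ q
      Y₀≤F∸q = iter-predW-≤ b (F ∸ q)

      ViewLit-rel : ∀ {v} S → v represents f → ViewLit v p q (rel S a b) ⇔ X₀ ≤ Y₀
      ViewLit-rel S whole = ⇔-refl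
      ViewLit-rel S rep@(ends _ _ _) = mk⇔ (λ _ → X₀≤Y₀) (λ _ → tt)
        where
        X₀≤Y₀ : X₀ ≤ Y₀
        X₀≤Y₀ = ≤-trans (iter-sucW-≤-+ a F (suc p))
                  (≤-trans (<⇒≤ (ends-apart (2K≤long rep) p≤M q≤M a≤C b≤C)) (∸≤iter-predW b (F ∸ q)))

UHolds? : ∀ {k} (w : List (Fin k)) U i → Dec (UHolds w U i)
UHolds? w (Q s) i = Maybe.≡-dec _≟ᶠ_ (letterAt w i) (just s)
UHolds? w isMin i = i ≟ 1
UHolds? w isMax i = i ≟ length w

head≟ : ∀ {r} (h : Head r) S → Dec (h ≡ hd S)
head≟ (hd S′) S with S′ ≟ᶠ S
... | yes refl = yes refl
... | no  S′≢S = no (λ { refl → S′≢S refl })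
head≟ bot S = no (λ ())

LitHolds? : ∀ {k r} (w : List (Fin k)) (R : Fin r → ℕ → ℕ → Bool) x y (l : Lit k r) → Dec (LitHolds w R x y l)
LitHolds? w R x y (posU U var t) = UHolds? _ U _
LitHolds? w R x y (negU U var t) = ¬? (UHolds? _ U _)
LitHolds? w R x y eqxy           = x ≟ y
LitHolds? w R x y ltxy           = x <? y
LitHolds? w R x y (rel S a b)    = T? _ ×-dec (_ ≤? _)

Closed : ∀ {k r} → List (Clause k r) → (Fin r → ℕ → ℕ → Bool) → List (Fin k) → Set
Closed {k} {r} cls R w =
  ∀ x y → 1 ≤ x → x ≤ length w → 1 ≤ y → y ≤ length w → (c : Clause k r) → c ∈ cls → ∀ S →
  Clause.head c ≡ hd S → x ≤ y → All (LitHolds w R x y) (Clause.body c) → T (R S x y)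

module Saturation {k r : ℕ} (cls : List (Clause k r)) (w : List (Fin k)) where

  Fires : (Fin r → ℕ → ℕ → Bool) → Fin r → ℕ → ℕ → Set
  Fires R S x y = Any (λ c → Clause.head c ≡ hd S × All (LitHolds w R x y) (Clause.body c)) cls

  fires? : ∀ R S x y → Dec (Fires R S x y)
  fires? R S x y = any? (λ c → head≟ (Clause.head c) S ×-dec all? (LitHolds? w R x y) (Clause.body c)) cls

  stage : ℕ → Fin r → ℕ → ℕ → Bool
  stage zero    S x y = false
  stage (suc i) S x y = stage i S x y ∨ ⌊ fires? (stage i) S x y ⌋

  stage-suc⁻ : ∀ i S x y → T (stage (suc i) S x y) →
    T (stage i S x y) ⊎ Σ (Clause k r) λ c → c ∈ cls × Clause.head c ≡ hd S × All (LitHolds w (stage i) x y) (Clause.body c)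
  stage-suc⁻ i S x y h with Equivalence.to T-∨ h
  ... | inj₁ earlier = inj₁ earlier
  ... | inj₂ fired with find (toWitness fired)
  ...   | c , c∈ , head≡ , lits = inj₂ (c , c∈ , head≡ , lits)

  Atom : Set
  Atom = Fin r × ℕ × ℕ

  stageᵃ : ℕ → Atom → Bool
  stageᵃ i (S , x , y) = stage i S x y

  positions : List ℕ
  positions = map suc (upTo (length w))

  atoms : List Atom
  atoms = cartesianProduct (allFin r) (cartesianProduct positions positions)

  Stable : ℕ → Set
  Stable j = All (λ t → T (stageᵃ (suc j) t) → T (stageᵃ j t)) atoms

  stable? : ∀ j → Dec (Stable j)
  stable? j = all? (λ t → T? (stageᵃ (suc j) t) →-dec T? (stageᵃ j t)) atoms

  stage-mono : ∀ i t → T (stageᵃ i t) → T (stageᵃ (suc i) t)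
  stage-mono i t h = Equivalence.from T-∨ (inj₁ h)

  stable-or-growing : ∀ i → Σ ℕ Stable ⊎ i ≤ count (stageᵃ i) atoms
  stable-or-growing zero = inj₂ z≤n
  stable-or-growing (suc i) with stable-or-growing i
  ... | inj₁ st = inj₁ st
  ... | inj₂ i≤ with stable? i
  ...   | yes st = inj₁ (i , st)
  ...   | no ¬st = inj₂ (≤-trans (s≤s i≤) (count-< (stageᵃ i) (stageᵃ (suc i)) (stage-mono i) atoms
                       (¬All⇒Any¬ (λ t → T? (stageᵃ (suc i) t) →-dec T? (stageᵃ i t)) atoms ¬st)))

  -- An unstable round adds one of the finitely many atoms of w.
  stabilises : Σ ℕ Stable
  stabilises with stable-or-growing (suc (length atoms))
  ... | inj₁ st = st
  ... | inj₂ le = ⊥-elim (<⇒≱ (s≤s (count-≤-length (stageᵃ (suc (length atoms))) atoms)) le)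

  final : ℕ
  final = proj₁ stabilises

  least : Fin r → ℕ → ℕ → Bool
  least = stage final

  ∈-positions : ∀ {x} → 1 ≤ x → x ≤ length w → x ∈ positions
  ∈-positions {suc x} _ x≤w = ∈-map⁺ suc (∈-upTo⁺ x≤w)

  least-closed : Closed cls least w
  least-closed x y 1≤x x≤w 1≤y y≤w c c∈ S head≡ _ lits =
    All.lookup (proj₂ stabilises) {S , x , y}
      (∈-cartesianProduct⁺ (∈-allFin S) (∈-cartesianProduct⁺ (∈-positions 1≤x x≤w) (∈-positions 1≤y y≤w)))
      (Equivalence.from T-∨ (inj₂ (fromWitness {a? = fires? least S x y} (lose c∈ (head≡ , lits)))))

module Construction {k r : ℕ} (cls : List (Clause k r)) (C : ℕ) where
  open Views k r C

  data NT : Set where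
    any  : NT
    atom : Fin r → ℕ → ℕ → NT

  #NT : ℕ
  #NT = suc (r * (suc M * suc M))

  -- Margins are clamped to M, so encode is injective only on margins ≤ M.
  cap : ℕ → Fin (suc M)
  cap n = fromℕ< (s≤s (m⊓n≤m M n))

  toℕ-cap : ∀ {n} → n ≤ M → toℕ (cap n) ≡ n
  toℕ-cap {n} n≤M = trans (toℕ-fromℕ< (s≤s (m⊓n≤m M n))) (m≥n⇒m⊓n≡n n≤M)

  encode : NT → Fin #NT
  encode any          = fzero
  encode (atom S p q) = fsuc (combine S (combine (cap p) (cap q)))

  decodeAtom : Fin r × Fin (suc M * suc M) → NT
  decodeAtom (S , j) = atom S (toℕ (proj₁ (remQuot {suc M} (suc M) j))) (toℕ (proj₂ (remQuot {suc M} (suc M) j)))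

  decode : Fin #NT → NT
  decode fzero    = any
  decode (fsuc i) = decodeAtom (remQuot {r} (suc M * suc M) i)

  decode-encode : ∀ S {p q} → p ≤ M → q ≤ M → decode (encode (atom S p q)) ≡ atom S p q
  decode-encode S {p} {q} p≤M q≤M = begin
    decodeAtom (remQuot {r} (suc M * suc M) (combine S pq))
      ≡⟨ cong decodeAtom (remQuot-combine {n = r} {k = suc M * suc M} S pq) ⟩
    decodeAtom (S , pq)
      ≡⟨ cong (λ (i , j) → atom S (toℕ i) (toℕ j)) (remQuot-combine {n = suc M} {k = suc M} (cap p) (cap q)) ⟩
    atom S (toℕ (cap p)) (toℕ (cap q))
      ≡⟨ cong₂ (atom S) (toℕ-cap p≤M) (toℕ-cap q≤M) ⟩
    atom S p q ∎
    where
    open ≡-Reasoning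
    pq : Fin (suc M * suc M)
    pq = combine (cap p) (cap q)

  viewAlt : View → Alt k #NT
  viewAlt (short g)  = term g
  viewAlt (long ℓ ρ) = nt ℓ (encode any) ρ

  cutAlt : Word → Word → ℕ → ℕ → Fin r → Alt k #NT
  cutAlt wˡ wʳ X₀ Y₀ S =
    nt (Cut.prefix M wˡ X₀ Y₀) (encode (atom S (Cut.p′ M wˡ X₀ Y₀) (Cut.q′ M wʳ X₀ Y₀))) (Cut.suffix M wʳ X₀ Y₀)

  litAlt : View → ℕ → ℕ → Lit k r → Alt k #NT
  litAlt v p q (rel S a b) = cutAlt (viewˡ v) (viewʳ v) (viewStart v p a) (viewEnd v q b) S
  litAlt v p q _           = viewAlt v

  cutAlt-long : ∀ (ℓ mid ρ : Word) X₀ Y₀ S → X₀ ≤ length ℓ →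
    cutAlt ℓ ρ X₀ Y₀ S ≡ cutAlt (ℓ ++ mid ++ ρ) (ℓ ++ mid ++ ρ) X₀ (length (ℓ ++ mid) + Y₀) S
  cutAlt-long ℓ mid ρ X₀ Y₀ S X₀≤ℓ
    rewrite cut-prefix-++ M ℓ (mid ++ ρ) X₀ (length (ℓ ++ mid) + Y₀) Y₀ X₀≤ℓ
          | sym (++-assoc ℓ mid ρ)
          | cut-suffix-++ M (ℓ ++ mid) ρ X₀ X₀ Y₀ | cut-q′-++ M (ℓ ++ mid) ρ X₀ X₀ Y₀ = refl

  litAlt-rel : ∀ {v f p q a b} S → v represents f → p ≤ M → q ≤ M → a ≤ C → b ≤ C →
    litAlt v p q (rel S a b) ≡ cutAlt f f (iter a (sucW (length f)) (suc p)) (iter b predW (length f ∸ q)) S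
  litAlt-rel S whole _ _ _ _ = refl
  litAlt-rel {p = p} {q} {a} {b} S (ends {ℓ} {ρ} mid ℓ≡K ρ≡K) p≤M q≤M a≤C b≤C
    rewrite start-long {ℓ} {mid} {ρ} ℓ≡K ρ≡K p≤M a≤C | end-long {ℓ} {mid} {ρ} ℓ≡K ρ≡K q≤M b≤C =
    cutAlt-long ℓ mid ρ _ _ S (start-long-≤ {ℓ} {mid} {ρ} ℓ≡K ρ≡K p≤M a≤C)

  wordsOfLength : ℕ → List Word
  wordsOfLength zero    = [] ∷ []
  wordsOfLength (suc n) = cartesianProductWith _∷_ (allFin k) (wordsOfLength n)

  ∈-wordsOfLength : ∀ g → g ∈ wordsOfLength (length g)
  ∈-wordsOfLength []      = here refl
  ∈-wordsOfLength (c ∷ g) = ∈-cartesianProductWith⁺ _∷_ (∈-allFin c) (∈-wordsOfLength g)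

  shortWords : List Word
  shortWords = concatMap wordsOfLength (upTo (K + K))

  views : List View
  views = map short shortWords ++ map (uncurry long) (cartesianProduct (wordsOfLength K) (wordsOfLength K))

  Candidate : Set
  Candidate = Fin r × Clause k r × View × ℕ × ℕ

  candidates : List Candidate
  candidates = cartesianProduct (allFin r) (cartesianProduct cls (cartesianProduct views
                 (cartesianProduct (upTo (suc M)) (upTo (suc M)))))

  Fits : View → ℕ → ℕ → Set
  Fits (short g)  p q = p + q < length g
  Fits (long ℓ ρ) p q = length ℓ ≡ K × length ρ ≡ K

  Admissible : Candidate → Set
  Admissible (S , c , v , p , q) =
    Clause.head c ≡ hd S × p ≤ M × q ≤ M × Fits v p q × All (ViewLit v p q) (Clause.body c)

  fits? : ∀ v p q → Dec (Fits v p q)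
  fits? (short g)  p q = _ <? _
  fits? (long ℓ ρ) p q = (length ℓ ≟ K) ×-dec (length ρ ≟ K)

  ViewLit? : ∀ v p q l → Dec (ViewLit v p q l)
  ViewLit? v          p q (posU U var t) = UHolds? _ U _
  ViewLit? v          p q (negU U var t) = ¬? (UHolds? _ U _)
  ViewLit? (short g)  p q eqxy           = _ ≟ _
  ViewLit? (long _ _) p q eqxy           = no id
  ViewLit? (short g)  p q ltxy           = _ <? _
  ViewLit? (long _ _) p q ltxy           = yes tt
  ViewLit? (short g)  p q (rel S a b)    = _ ≤? _
  ViewLit? (long _ _) p q (rel S a b)    = yes tt

  admissible? : ∀ t → Dec (Admissible t)
  admissible? (S , c , v , p , q) =
    head≟ (Clause.head c) S ×-dec p ≤? M ×-dec q ≤? M ×-dec fits? v p q ×-dec all? (ViewLit? v p q) (Clause.body c)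

  candidateRule : Candidate → Rule k #NT
  candidateRule (S , c , v , p , q) = encode (atom S p q) ⟶ (viewAlt v ∷⁺ map (litAlt v p q) (Clause.body c))

  anyRule : Fin k → Rule k #NT
  anyRule c = encode any ⟶ (nt (c ∷ []) (encode any) [] ∷⁺ [])

  anyRules : List (Rule k #NT)
  anyRules = (encode any ⟶ (term [] ∷⁺ [])) ∷ map anyRule (allFin k)

  rules : List (Rule k #NT)
  rules = anyRules ++ map candidateRule (filter admissible? candidates)

  grammar : Fin #NT → Grammar k
  grammar s = record { nNT = #NT ; start = s ; rules = rules }

  Forced : Fin r → ℕ → ℕ → Word → Set
  Forced S p q f = ∀ (A B : Word) → Framed M A f B p q → ∀ R → Closed cls R (A ++ f ++ B) →
                   T (R S (length A + suc p) (length A + (length f ∸ q)))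

  Sem : NT → Word → Set
  Sem any          f = ⊤
  Sem (atom S p q) f = p + q < length f × Forced S p q f

  SemAlt : Alt k #NT → Word → Set
  SemAlt (term u)   f = u ≡ f
  SemAlt (nt u B v) f = Σ Word λ g → f ≡ u ++ g ++ v × Sem (decode B) g

  module _ (bounded : ∀ c → c ∈ cls → All Bounded (Clause.body c)) where

    module _ {A f B p q} (fr : Framed M A f B p q) {v} (rep : v represents f)
             (R : Fin r → ℕ → ℕ → Bool) (closed : Closed cls R (A ++ f ++ B)) where
      open Framed fr
      open Framing fr

      rel-sound : ∀ {S a b} (a≤C : a ≤ C) (b≤C : b ≤ C) → ViewLit v p q (rel S a b) →
                  SemAlt (litAlt v p q (rel S a b)) f → LitHolds w R x y (rel S a b)
      rel-sound {S} {a} {b} a≤C b≤C vl alt rewrite RelLit.rel-start a≤C b≤C | RelLit.rel-end a≤C b≤C =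
        subst₂ (λ i j → T (R S i j)) cut-start cut-end forced ,
        +-monoʳ-≤ (length A) X₀≤Y₀
        where
        open RelLit a≤C b≤C
        X₀≤Y₀ : X₀ ≤ Y₀
        X₀≤Y₀ = Equivalence.to (ViewLit-rel S rep) vl
        open FramedCut M fr 1+p≤X₀ X₀≤Y₀ Y₀≤F∸q
        cut-derived : SemAlt (cutAlt f f X₀ Y₀ S) f
        cut-derived = subst (λ α → SemAlt α f) (litAlt-rel S rep p≤M q≤M a≤C b≤C) alt
        sem-factor : Sem (atom S p′ q′) factor
        sem-factor with cut-derived
        ... | g , f≡ , sem = subst₂ Sem (decode-encode S (m⊓n≤m M (X₀ ∸ 1)) (m⊓n≤m M (length f ∸ Y₀)))
                                   (cut-middle f≡) sem
        forced : T (R S (length (A ++ prefix) + suc p′) (length (A ++ prefix) + (length factor ∸ q′)))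
        forced = proj₂ sem-factor (A ++ prefix) (suffix ++ B) cut-framed R
                   (subst (Closed cls R) cut-context closed)

      lit-sound : ∀ l → Bounded l → ViewLit v p q l → SemAlt (litAlt v p q l) f → LitHolds w R x y l
      lit-sound (rel S a b)    (a≤C , b≤C) vl alt = rel-sound a≤C b≤C vl alt
      lit-sound l@(posU _ _ _) bd vl _ = Equivalence.from (LitHolds⇔ViewLit rep l bd tt R) vl
      lit-sound l@(negU _ _ _) bd vl _ = Equivalence.from (LitHolds⇔ViewLit rep l bd tt R) vl
      lit-sound eqxy           bd vl _ = Equivalence.from (LitHolds⇔ViewLit rep eqxy bd tt R) vl
      lit-sound ltxy           bd vl _ = Equivalence.from (LitHolds⇔ViewLit rep ltxy bd tt R) vl

    represents-viewAlt : ∀ {v p q f} → Fits v p q → SemAlt (viewAlt v) f → v represents f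
    represents-viewAlt {short g}  _           refl           = whole
    represents-viewAlt {long ℓ ρ} (ℓ≡K , ρ≡K) (mid , refl , _) = ends mid ℓ≡K ρ≡K

    margins-fit : ∀ {v p q f} → p ≤ M → q ≤ M → Fits v p q → v represents f → p + q < length f
    margins-fit _   _   fits whole            = fits
    margins-fit p≤M q≤M _    rep@(ends _ _ _) =
      ≤-trans (s≤s (+-mono-≤ p≤M q≤M)) (≤-trans (≤-reflexive (1+M+M≡K C)) (≤-trans (m≤m+n K K) (2K≤long rep)))
      where
      1+M+M≡K : ∀ C → suc (suc C + suc C) ≡ suc (suc (suc (C + C)))
      1+M+M≡K = solve-∀

    candidate-sound : ∀ {S c v p q f} → Admissible (S , c , v , p , q) → c ∈ cls →
      All (λ α → SemAlt α f) (viewAlt v ∷ map (litAlt v p q) (Clause.body c)) → Sem (decode (encode (atom S p q))) f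
    candidate-sound {S} {c} {v} {p} {q} {f} (head≡ , p≤M , q≤M , fits , vls) c∈ (view ∷ alts) =
      subst (λ n → Sem n f) (sym (decode-encode S p≤M q≤M)) (margins-fit p≤M q≤M fits rep , forced)
      where
      rep : v represents f
      rep = represents-viewAlt fits view
      forced : Forced S p q f
      forced A B fr R closed =
        closed x y pos-x (≤-trans x≤y y≤w) (≤-trans pos-x x≤y) y≤w c c∈ S head≡ x≤y
          (All.zipWith (λ { {l} (bd , vl , alt) → lit-sound fr rep R closed l bd vl alt })
             (bounded c c∈ , All.zip (vls , All-map⁻ alts)))
        where open Framing fr

    anyRules-lhs : ∀ {ρ} → ρ ∈ anyRules → Rule.lhs ρ ≡ encode any
    anyRules-lhs (here refl) = refl
    anyRules-lhs (there ∈map) with ∈-map⁻ anyRule ∈map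
    ... | _ , _ , refl = refl

    rule-sound : ∀ {ρ f} → ρ ∈ rules → All (λ α → SemAlt α f) (toList (Rule.rhs ρ)) → Sem (decode (Rule.lhs ρ)) f
    rule-sound {ρ} {f} ρ∈ alts with ∈-++⁻ anyRules ρ∈
    ... | inj₁ ∈any = subst (λ i → Sem (decode i) f) (sym (anyRules-lhs ∈any)) tt
    ... | inj₂ ∈cand with ∈-map⁻ candidateRule ∈cand
    ... | (S , c , v , p , q) , t∈ , refl with ∈-filter⁻ admissible? {xs = candidates} t∈
    ...   | t∈cands , adm =
      candidate-sound adm (proj₁ (∈-cartesianProduct⁻ cls _ (proj₂ (∈-cartesianProduct⁻ (allFin r) _ t∈cands)))) alts

    module _ (s : Fin #NT) where
      sound : ∀ {i f} → Derives (grammar s) i f → Sem (decode i) f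
      sound-alts : ∀ {αs f} → All (λ α → DerivesAlt (grammar s) α f) αs → All (λ α → SemAlt α f) αs
      sound (byRule ρ∈ ds) = rule-sound ρ∈ (sound-alts ds)
      sound-alts []            = []
      sound-alts (dTerm  ∷ ds) = refl ∷ sound-alts ds
      sound-alts (dNt d  ∷ ds) = (_ , refl , sound d) ∷ sound-alts ds

    module _ (s : Fin #NT) where

      any-complete : ∀ g → Derives (grammar s) (encode any) g
      any-complete []      = byRule (here refl) (dTerm ∷ [])
      any-complete (c ∷ g) = subst (Derives (grammar s) (encode any)) (cong (c ∷_) (++-identityʳ g))
        (byRule (∈-++⁺ˡ (there (∈-map⁺ anyRule (∈-allFin c)))) (dNt (any-complete g) ∷ []))

      viewAlt-complete : ∀ {v f} → v represents f → DerivesAlt (grammar s) (viewAlt v) f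
      viewAlt-complete whole          = dTerm
      viewAlt-complete (ends mid _ _) = dNt (any-complete mid)

    long-represents : ∀ f → K + K ≤ length f → long (take K f) (drop (length f ∸ K) f) represents f
    long-represents f 2K≤f = subst (long ℓ ρ represents_) (take++drop-take++drop K (length f ∸ K) f K≤f∸K)
      (ends (drop K (take (length f ∸ K) f)) ℓ≡K ρ≡K)
      where
      ℓ ρ : Word
      ℓ = take K f
      ρ = drop (length f ∸ K) f
      K≤f∸K : K ≤ length f ∸ K
      K≤f∸K = m+n≤o⇒m≤o∸n K 2K≤f
      ℓ≡K : length ℓ ≡ K
      ℓ≡K = trans (length-take K f) (m≤n⇒m⊓n≡m (≤-trans (m≤m+n K K) 2K≤f))
      ρ≡K : length ρ ≡ K
      ρ≡K = trans (length-drop (length f ∸ K) f) (m∸[m∸n]≡n (≤-trans (m≤m+n K K) 2K≤f))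

    viewOf : ∀ f {p q} → p + q < length f → Σ View λ v → v represents f × v ∈ views × Fits v p q
    viewOf f p+q<f with length f <? K + K
    ... | yes f<2K = short f , whole ,
            ∈-++⁺ˡ (∈-map⁺ short (∈-concatMap⁺ wordsOfLength (lose (∈-upTo⁺ f<2K) (∈-wordsOfLength f)))) , p+q<f
    ... | no  f≮2K = long ℓ ρ , rep ,
            ∈-++⁺ʳ (map short shortWords) (∈-map⁺ (uncurry long)
              (∈-cartesianProduct⁺ (subst (λ n → ℓ ∈ wordsOfLength n) ℓ≡K (∈-wordsOfLength ℓ))
                                   (subst (λ n → ρ ∈ wordsOfLength n) ρ≡K (∈-wordsOfLength ρ)))) ,
            ℓ≡K , ρ≡K
      where
      ℓ ρ : Word
      ℓ = take K f
      ρ = drop (length f ∸ K) f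
      rep : long ℓ ρ represents f
      rep = long-represents f (≮⇒≥ f≮2K)
      ℓ≡K : length ℓ ≡ K
      ℓ≡K = proj₁ (long-lengths rep)
      ρ≡K : length ρ ≡ K
      ρ≡K = proj₂ (long-lengths rep)

    module Completeness (s : Fin #NT) (w : Word) where
      open Saturation cls w

      DerivableAt : ℕ → Set
      DerivableAt i = ∀ S {A f B p q} → Framed M A f B p q → A ++ f ++ B ≡ w →
        T (stage i S (length A + suc p) (length A + (length f ∸ q))) → Derives (grammar s) (encode (atom S p q)) f

      module _ {i} (ih : DerivableAt i) {A f B p q} (fr : Framed M A f B p q) (A++f++B≡w : A ++ f ++ B ≡ w)
               {v} (rep : v represents f) where
        open Framed fr
        open Framing fr hiding (w)

        rel-complete : ∀ {S a b} (a≤C : a ≤ C) (b≤C : b ≤ C) → LitHolds (A ++ f ++ B) (stage i) x y (rel S a b) →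
          ViewLit v p q (rel S a b) × DerivesAlt (grammar s) (litAlt v p q (rel S a b)) f
        rel-complete {S} {a} {b} a≤C b≤C (holds , le) =
          Equivalence.from (ViewLit-rel S rep) X₀≤Y₀ ,
          subst (λ α → DerivesAlt (grammar s) α f) (sym (litAlt-rel S rep p≤M q≤M a≤C b≤C))
            (subst (DerivesAlt (grammar s) (cutAlt f f X₀ Y₀ S)) (sym cut-split)
              (dNt (ih S cut-framed
                     (trans (sym cut-context) A++f++B≡w) holds′)))
          where
          open RelLit a≤C b≤C
          X₀≤Y₀ : X₀ ≤ Y₀
          X₀≤Y₀ = +-cancelˡ-≤ (length A) _ _ (subst₂ _≤_ rel-start rel-end le)
          open FramedCut M fr 1+p≤X₀ X₀≤Y₀ Y₀≤F∸q
          holds′ : T (stage i S (length (A ++ prefix) + suc p′) (length (A ++ prefix) + (length factor ∸ q′)))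
          holds′ = subst₂ (λ x′ y′ → T (stage i S x′ y′)) (trans rel-start (sym cut-start))
                     (trans rel-end (sym cut-end)) holds

        lit-complete : ∀ l → Bounded l → LitHolds (A ++ f ++ B) (stage i) x y l →
          ViewLit v p q l × DerivesAlt (grammar s) (litAlt v p q l) f
        lit-complete (rel S a b)    (a≤C , b≤C) holds = rel-complete a≤C b≤C holds
        lit-complete l@(posU _ _ _) bd holds = Equivalence.to (LitHolds⇔ViewLit rep l bd tt (stage i)) holds , viewAlt-complete s rep
        lit-complete l@(negU _ _ _) bd holds = Equivalence.to (LitHolds⇔ViewLit rep l bd tt (stage i)) holds , viewAlt-complete s rep
        lit-complete eqxy           bd holds = Equivalence.to (LitHolds⇔ViewLit rep eqxy bd tt (stage i)) holds , viewAlt-complete s rep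
        lit-complete ltxy           bd holds = Equivalence.to (LitHolds⇔ViewLit rep ltxy bd tt (stage i)) holds , viewAlt-complete s rep

      complete : ∀ i → DerivableAt i
      complete zero    S fr eq ()
      complete (suc i) S {A} {f} {B} {p} {q} fr eq holds with stage-suc⁻ i S _ _ holds
      ... | inj₁ earlier = complete i S fr eq earlier
      ... | inj₂ (c , c∈ , head≡ , lits) =
        byRule (∈-++⁺ʳ anyRules (∈-map⁺ candidateRule (∈-filter⁺ admissible? cand∈ admissible)))
          (viewAlt-complete s rep ∷ All-map⁺ (All.map proj₂ per-lit))
        where
        open Framed fr
        open Framing fr using (x; y)
        v∈ = viewOf f p+q<f
        v = proj₁ v∈
        rep = proj₁ (proj₂ v∈)
        per-lit : All (λ l → ViewLit v p q l × DerivesAlt (grammar s) (litAlt v p q l) f) (Clause.body c)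
        per-lit = All.zipWith (λ { {l} (bd , lh) → lit-complete {i} (complete i) fr eq rep l bd lh })
                    (bounded c c∈ , subst (λ u → All (LitHolds u (stage i) x y) (Clause.body c)) (sym eq) lits)
        admissible : Admissible (S , c , v , p , q)
        admissible = head≡ , p≤M , q≤M , proj₂ (proj₂ (proj₂ v∈)) , All.map proj₁ per-lit
        cand∈ : (S , c , v , p , q) ∈ candidates
        cand∈ = ∈-cartesianProduct⁺ (∈-allFin S) (∈-cartesianProduct⁺ c∈
                  (∈-cartesianProduct⁺ (proj₁ (proj₂ (proj₂ v∈)))
                    (∈-cartesianProduct⁺ (∈-upTo⁺ (s≤s p≤M)) (∈-upTo⁺ (s≤s q≤M)))))

module BottomAsRelation {k r : ℕ} (cls : List (Clause k r)) where

  liftLit : Lit k r → Lit k (suc r)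
  liftLit (posU U v t) = posU U v t
  liftLit (negU U v t) = negU U v t
  liftLit eqxy         = eqxy
  liftLit ltxy         = ltxy
  liftLit (rel S a b)  = rel (fsuc S) a b

  liftHead : Head r → Fin (suc r)
  liftHead (hd S) = fsuc S
  liftHead bot    = fzero

  liftClause : Clause k r → Clause k (suc r)
  liftClause (clause body h) = clause (map liftLit body) (hd (liftHead h))

  -- Relation 0 stands for ⊥, and is spread from [x + 1, y] and [x, y − 1] to [x, y].
  extendˡ extendʳ : Clause k (suc r)
  extendˡ = clause (rel fzero 1 0 ∷ []) (hd fzero)
  extendʳ = clause (rel fzero 0 1 ∷ []) (hd fzero)

  cls⁺ : List (Clause k (suc r))
  cls⁺ = map liftClause cls ++ extendˡ ∷ extendʳ ∷ []

  offset : Lit k r → ℕ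
  offset (posU _ _ t) = ∣ t ∣
  offset (negU _ _ t) = ∣ t ∣
  offset eqxy         = 0
  offset ltxy         = 0
  offset (rel _ a b)  = a + b

  -- The suc accounts for the offset 1 in extendˡ and extendʳ.
  C : ℕ
  C = suc (sum (map (λ c → sum (map offset (Clause.body c))) cls))

  open Views k (suc r) C using (Bounded; M)

  bounded-lift : ∀ l → offset l ≤ C → Bounded (liftLit l)
  bounded-lift (posU _ _ t) t≤C = t≤C
  bounded-lift (negU _ _ t) t≤C = t≤C
  bounded-lift eqxy         _   = tt
  bounded-lift ltxy         _   = tt
  bounded-lift (rel _ a b)  a+b≤C = ≤-trans (m≤m+n a b) a+b≤C , ≤-trans (m≤n+m b a) a+b≤C

  bounded : ∀ c → c ∈ cls⁺ → All Bounded (Clause.body c)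
  bounded c c∈ with ∈-++⁻ (map liftClause cls) c∈
  ... | inj₂ (here refl)         = (s≤s z≤n , z≤n) ∷ []
  ... | inj₂ (there (here refl)) = (z≤n , s≤s z≤n) ∷ []
  ... | inj₁ ∈lifted with ∈-map⁻ liftClause ∈lifted
  ...   | clause body h , c₀∈ , refl = All-map⁺ (All.tabulate λ {l} l∈ → bounded-lift l
            (≤-trans (∈⇒≤sum (∈-map⁺ offset l∈)) (≤-trans (∈⇒≤sum (∈-map⁺ _ c₀∈)) (n≤1+n _))))

  LitHolds-lift : ∀ w (R : Fin (suc r) → ℕ → ℕ → Bool) x y l → LitHolds w R x y (liftLit l) ≡ LitHolds w (R ∘ fsuc) x y l
  LitHolds-lift w R x y (posU U v t) = refl
  LitHolds-lift w R x y (negU U v t) = refl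
  LitHolds-lift w R x y eqxy         = refl
  LitHolds-lift w R x y ltxy         = refl
  LitHolds-lift w R x y (rel S a b)  = refl

  IsModel : List (Fin k) → (Fin r → ℕ → ℕ → Bool) → Set
  IsModel w R = (x y : ℕ) → 1 ≤ x → x ≤ length w → 1 ≤ y → y ≤ length w →
                (c : Clause k r) → c ∈ cls → x ≤ y → All (LitHolds w R x y) (Clause.body c) → HeadHolds R x y (Clause.head c)

  withBottom : (Fin r → ℕ → ℕ → Bool) → Fin (suc r) → ℕ → ℕ → Bool
  withBottom R fzero    _ _ = false
  withBottom R (fsuc S)     = R S

  model⇒closed : ∀ w R → IsModel w R → Closed cls⁺ (withBottom R) w
  model⇒closed w R model x y 1≤x x≤w 1≤y y≤w c c∈ S head≡ x≤y lits with ∈-++⁻ (map liftClause cls) c∈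
  model⇒closed w R model x y 1≤x x≤w 1≤y y≤w c c∈ S head≡ x≤y ((() , _) ∷ []) | inj₂ (here refl)
  model⇒closed w R model x y 1≤x x≤w 1≤y y≤w c c∈ S head≡ x≤y ((() , _) ∷ []) | inj₂ (there (here refl))
  ... | inj₁ ∈lifted with ∈-map⁻ liftClause ∈lifted
  ...   | clause body h , c₀∈ , refl = head-holds h head≡
          (model x y 1≤x x≤w 1≤y y≤w (clause body h) c₀∈ x≤y
            (All.map (λ {l} → subst id (LitHolds-lift w (withBottom R) x y l)) (All-map⁻ lits)))
    where
    head-holds : ∀ h → hd (liftHead h) ≡ hd S → HeadHolds R x y h → T (withBottom R S x y)
    head-holds (hd S₀) refl holds = holds
    head-holds bot     refl ()

  module Least (w : List (Fin k)) where
    open Saturation cls⁺ w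

    n : ℕ
    n = length w

    extendˡ∈ : extendˡ ∈ cls⁺
    extendˡ∈ = ∈-++⁺ʳ (map liftClause cls) (here refl)

    extendʳ∈ : extendʳ ∈ cls⁺
    extendʳ∈ = ∈-++⁺ʳ (map liftClause cls) (there (here refl))

    bottom-extendˡ : ∀ d y → suc d ≤ y → y ≤ n → T (least fzero (suc d) y) → T (least fzero 1 y)
    bottom-extendˡ zero    y _  _   holds = holds
    bottom-extendˡ (suc d) y le y≤n holds = bottom-extendˡ d y (≤-trans (n≤1+n _) le) y≤n
      (least-closed (suc d) y (s≤s z≤n) (≤-trans (n≤1+n _) (≤-trans le y≤n)) (≤-trans (s≤s z≤n) le) y≤n _ extendˡ∈ fzero refl
         (≤-trans (n≤1+n _) le)
         ((subst (λ i → T (least fzero i y)) (sym next) holds , subst (_≤ y) (sym next) le) ∷ []))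
      where
      next : sucW n (suc d) ≡ suc (suc d)
      next = sucW-< (≤-trans le y≤n)

    bottom-extendʳ : ∀ m y → y + m ≡ n → 1 ≤ y → T (least fzero 1 y) → T (least fzero 1 n)
    bottom-extendʳ zero    y       y+0≡n _ holds = subst (λ i → T (least fzero 1 i)) (trans (sym (+-identityʳ y)) y+0≡n) holds
    bottom-extendʳ (suc m) (suc y) y+m≡n _ holds = bottom-extendʳ m (suc (suc y)) y+m≡n′ (s≤s z≤n)
      (least-closed 1 (suc (suc y)) (s≤s z≤n) (≤-trans (s≤s z≤n) 2+y≤n) (s≤s z≤n) 2+y≤n _ extendʳ∈ fzero refl (s≤s z≤n)
        ((holds , s≤s z≤n) ∷ []))
      where
      y+m≡n′ : suc (suc y) + m ≡ n
      y+m≡n′ = trans (sym (+-suc (suc y) m)) y+m≡n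
      2+y≤n : suc (suc y) ≤ n
      2+y≤n = subst (suc (suc y) ≤_) y+m≡n′ (m≤m+n _ m)

    least-model : ¬ T (least fzero 1 n) → IsModel w (least ∘ fsuc)
    least-model ¬bottom (suc d) y 1≤x x≤w 1≤y y≤w (clause body h) c∈ x≤y lits =
      head-holds h (least-closed (suc d) y 1≤x x≤w 1≤y y≤w (liftClause (clause body h)) (∈-++⁺ˡ (∈-map⁺ liftClause c∈))
        (liftHead h) refl x≤y (All-map⁺ (All.map (λ {l} → subst id (sym (LitHolds-lift w least (suc d) y l))) lits)))
      where
      head-holds : ∀ h → T (least (liftHead h) (suc d) y) → HeadHolds (least ∘ fsuc) (suc d) y h
      head-holds (hd S) holds = holds
      head-holds bot    holds = ¬bottom (bottom-extendʳ (n ∸ y) y (m+[n∸m]≡n y≤w) 1≤y (bottom-extendˡ d y x≤y y≤w holds))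

  open Construction cls⁺ C

  start : Fin #NT
  start = encode (atom fzero 0 0)

  whole-word : ∀ {w : List (Fin k)} → 0 < length w → Framed M [] w [] 0 0
  whole-word 0<w = record { p≤M = z≤n ; q≤M = z≤n ; A≈ = inj₁ refl ; B≈ = inj₁ refl ; p+q<f = 0<w }

  nonempty : ∀ {w : List (Fin k)} → w ≢ [] → 0 < length w
  nonempty {[]}    w≢[] = ⊥-elim (w≢[] refl)
  nonempty {_ ∷ _} _    = s≤s z≤n

  complementGrammar : Grammar k
  complementGrammar = grammar start

  language : ∀ w → LangG complementGrammar w ⇔ (w ≢ [] × ¬ Models w (formula r cls))
  language w = mk⇔ derivable⇒¬model ¬model⇒derivable
    where
    derivable⇒¬model : LangG complementGrammar w → w ≢ [] × ¬ Models w (formula r cls)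
    derivable⇒¬model d with subst (λ n → Sem n w) (decode-encode fzero z≤n z≤n) (sound bounded start d)
    ... | 0<w , forced = (λ { refl → <⇒≱ 0<w z≤n }) ,
      λ (R , model) → forced [] [] (whole-word 0<w) (withBottom R)
                        (subst (Closed cls⁺ (withBottom R)) (sym (++-identityʳ w)) (model⇒closed w R model))
    ¬model⇒derivable : w ≢ [] × ¬ Models w (formula r cls) → LangG complementGrammar w
    ¬model⇒derivable (w≢[] , ¬model) with T? (Saturation.least cls⁺ w fzero 1 (length w))
    ... | yes bottom = Completeness.complete bounded start w (Saturation.final cls⁺ w) fzero
                         (whole-word (nonempty w≢[])) (++-identityʳ w) bottom
    ... | no ¬bottom = ⊥-elim (¬model (_ , Least.least-model w ¬bottom))

lemma7 : {k : ℕ} (L : List (Fin k) → Set) → InclESOHorn L →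
    Σ (Grammar k) λ G → (w : List (Fin k)) → LangG G w ⇔ (w ≢ [] × ¬ L w)
lemma7 L (formula r cls , defines) = complementGrammar , λ w → ⇔-trans (language w) (mk⇔
  (λ (w≢[] , ¬model) → w≢[] , ¬model ∘ proj₂ ∘ Equivalence.to (defines w))
  (λ (w≢[] , ¬L) → w≢[] , λ model → ¬L (Equivalence.from (defines w) (w≢[] , model))))
  where open BottomAsRelation cls using (complementGrammar; language)
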